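{- Let $C$ be a polygonal chain of $n$ planar points and let $\omega$ be the width of the recursion tree of the Test-And-Divide algorithm on input $C$. Then the running time of the Test-And-Divide algorithm on $C$ is within $O(\omega n)$.
   Context: A polygonal chain is a sequence of points $p_1,\dots,p_n$ in the plane together with the segments joining consecutive points. It is simple if any two non-adjacent edges are disjoint or meet only at a vertex of the chain, and any two adjacent edges share only their common vertex. The Test-And-Divide algorithm computes the convex hull of a polygonal chain $C$: it tests in linear time whether $C$ is simple; if so it computes the convex hull of $C$ in linear time (Melkman's algorithm) and this call is a leaf of the recursion; otherwise it cuts $C$ into two consecutive subchains of sizes $\lceil n/2\rceil$ and $\lfloor n/2\rfloor$, recurses on each, and merges the two resulting convex hulls in linear time. Each node of the recursion tree corresponds to a subchain and costs time linear in its size. The width $\omega$ of the recursion tree is the maximum number of nodes at any level of the tree.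
   Formalization: The points of the polygonal chain $C$ have rational coordinates. -}

module Defs where

open import Data.Nat using (ℕ; zero; suc; _+_; _*_; _<_; _⊔_; ⌈_/2⌉)
open import Data.Rational using (ℚ; 0ℚ; 1ℚ) renaming (_+_ to _+ℚ_; _*_ to _*ℚ_; _-_ to _-ℚ_; _≤_ to _≤ℚ_)
open import Data.List using (List; []; _∷_; length; take; drop)
open import Data.Product using (_×_; _,_; ∃-syntax)
open import Relation.Binary.PropositionalEquality using (_≡_)
open import Relation.Nullary using (¬_)

Point : Set
Point = ℚ × ℚ

OnSeg : Point → Point → Point → Set
OnSeg (px , py) (ax , ay) (bx , by) =
  ∃[ t ] (0ℚ ≤ℚ t × t ≤ℚ 1ℚ
         × px ≡ ax +ℚ t *ℚ (bx -ℚ ax)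
         × py ≡ ay +ℚ t *ℚ (by -ℚ ay))

Chain : Set
Chain = List Point

-- k-th vertex (a default value is returned out of range; only used in range).
vtx : Chain → ℕ → Point
vtx []       _       = (0ℚ , 0ℚ)
vtx (p ∷ _)  zero    = p
vtx (_ ∷ ps) (suc k) = vtx ps k

Simple : Chain → Set
Simple C =
  (∀ i j → suc i < length C → suc j < length C → suc i < j →
     ∀ p → OnSeg p (vtx C i) (vtx C (suc i)) → OnSeg p (vtx C j) (vtx C (suc j)) →
     ∃[ k ] (k < length C × p ≡ vtx C k))
  ×
  (∀ i → suc (suc i) < length C →
     ∀ p → OnSeg p (vtx C i) (vtx C (suc i)) → OnSeg p (vtx C (suc i)) (vtx C (suc (suc i))) →
     p ≡ vtx C (suc i))

data Tree : Set where
  leaf : Chain → Tree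
  node : Chain → Tree → Tree → Tree

-- A simple chain gives a leaf (Melkman); otherwise C is cut into
-- its first ⌈n/2⌉ and last ⌊n/2⌋ points and both halves are recursed on.
data TAD : Chain → Tree → Set where
  tad-leaf : ∀ {C} → Simple C → TAD C (leaf C)
  tad-node : ∀ {C l r} → ¬ Simple C →
             TAD (take ⌈ length C /2⌉ C) l →
             TAD (drop ⌈ length C /2⌉ C) r →
             TAD C (node C l r)

levelCount : Tree → ℕ → ℕ
levelCount (leaf _)     zero    = 1
levelCount (node _ _ _) zero    = 1
levelCount (leaf _)     (suc d) = 0
levelCount (node _ l r) (suc d) = levelCount l d + levelCount r d

depth : Tree → ℕ
depth (leaf _)     = 0
depth (node _ l r) = suc (depth l ⊔ depth r)

maxLevel : Tree → ℕ → ℕ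
maxLevel t zero    = levelCount t zero
maxLevel t (suc m) = maxLevel t m ⊔ levelCount t (suc m)

width : Tree → ℕ
width t = maxLevel t (depth t)

-- Running time, where a node on a subchain of size m costs a * m + b
-- (linear in its size; leaf test+Melkman, or test+split+merge).
time : ℕ → ℕ → Tree → ℕ
time a b (leaf C)     = a * length C + b
time a b (node C l r) = a * length C + b + time a b l + time a b r

module Submission where

-- A node of cost a·m + b on a subchain of size m contributes a·m to the
-- "size" part and b to the "count" part of the running time, so
--   time = a · (total size of all subchains) + b · (number of nodes).
-- The count part is small: Test-And-Divide only cuts non-simple chains,
-- which have at least two points, so both halves are non-empty and the
-- recursion tree has fewer than 2n nodes.
-- The size part is the paper's argument: a subchain at depth d has at most
-- n/2^d + 1 points and level d holds at most ω nodes, so the total size is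
-- at most  Σ_d ω·n/2^d + #nodes ≤ 2ωn + 2n.  To stay in ℕ everything is
-- multiplied by 2^D (D the depth), using the weighted level count
-- Σ_{d ≤ D} 2^(D-d)·levelCount t d ≤ 2^(D+1)·ω.

open import Defs
open import Data.Nat using (ℕ; zero; suc; _+_; _*_; _^_; _≤_; _<_; _≤′_; ≤′-refl; ≤′-step; _⊔_; z≤n; s≤s; s≤s⁻¹; ⌈_/2⌉; >-nonZero)
open import Data.Nat.Properties
open import Data.Nat.Tactic.RingSolver using (solve-∀)
open import Data.List using (List; []; _∷_; length; take; drop)
open import Data.List.Properties using (length-take; length-drop; length-++; take++drop≡id)
open import Data.Product using (∃-syntax; _×_; _,_; proj₁; proj₂)
open import Data.Empty using (⊥-elim)
open import Relation.Nullary using (¬_)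
open import Relation.Binary.PropositionalEquality using (_≡_; refl; sym; trans; cong; subst)

firstHalf secondHalf : Chain → Chain
firstHalf  C = take ⌈ length C /2⌉ C
secondHalf C = drop ⌈ length C /2⌉ C

halves-length : ∀ C → length (firstHalf C) + length (secondHalf C) ≡ length C
halves-length C = trans (sym (length-++ (firstHalf C))) (cong length (take++drop≡id ⌈ length C /2⌉ C))

n≤⌈n/2⌉+⌈n/2⌉ : ∀ n → n ≤ ⌈ n /2⌉ + ⌈ n /2⌉
n≤⌈n/2⌉+⌈n/2⌉ n = subst (_≤ ⌈ n /2⌉ + ⌈ n /2⌉) (⌊n/2⌋+⌈n/2⌉≡n n) (+-monoˡ-≤ ⌈ n /2⌉ (⌊n/2⌋≤⌈n/2⌉ n))

⌈n/2⌉+⌈n/2⌉≤1+n : ∀ n → ⌈ n /2⌉ + ⌈ n /2⌉ ≤ suc n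
⌈n/2⌉+⌈n/2⌉≤1+n zero          = z≤n
⌈n/2⌉+⌈n/2⌉≤1+n (suc zero)    = ≤-refl
⌈n/2⌉+⌈n/2⌉≤1+n (suc (suc n)) =
  s≤s (subst (_≤ suc (suc n)) (sym (+-suc ⌈ n /2⌉ ⌈ n /2⌉)) (s≤s (⌈n/2⌉+⌈n/2⌉≤1+n n)))

at-most-half : ∀ {m n} → m ≤ ⌈ n /2⌉ → m + m ≤ suc n
at-most-half {m} {n} m≤ = ≤-trans (+-mono-≤ m≤ m≤) (⌈n/2⌉+⌈n/2⌉≤1+n n)

firstHalf-short : ∀ C → length (firstHalf C) + length (firstHalf C) ≤ suc (length C)
firstHalf-short C = at-most-half (subst (_≤ ⌈ n /2⌉) (sym (length-take ⌈ n /2⌉ C)) (m⊓n≤m ⌈ n /2⌉ n))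
  where n = length C

secondHalf-short : ∀ C → length (secondHalf C) + length (secondHalf C) ≤ suc (length C)
secondHalf-short C = at-most-half (subst (_≤ ⌈ n /2⌉) (sym (length-drop ⌈ n /2⌉ C))
                                    (m≤n+o⇒m∸n≤o n ⌈ n /2⌉ (n≤⌈n/2⌉+⌈n/2⌉ n)))
  where n = length C

drop-nonempty : ∀ {A : Set} k (xs : List A) → k < length xs → 1 ≤ length (drop k xs)
drop-nonempty zero    (x ∷ xs) _   = s≤s z≤n
drop-nonempty (suc k) (x ∷ xs) k<n = drop-nonempty k xs (s≤s⁻¹ k<n)

halves-nonempty : ∀ C → 2 ≤ length C → 1 ≤ length (firstHalf C) × 1 ≤ length (secondHalf C)
halves-nonempty (p ∷ []) (s≤s ())
halves-nonempty (p ∷ q ∷ ps) _ =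
  s≤s z≤n , drop-nonempty ⌈ length (p ∷ q ∷ ps) /2⌉ (p ∷ q ∷ ps) (⌈n/2⌉<n (length ps))

-- Chains of at most one point have no two edges, hence are simple;
-- so Test-And-Divide only ever cuts chains of at least two points.
short-simple : ∀ C → length C ≤ 1 → Simple C
short-simple C short =
    (λ i j 2+i≤n _ _ _ _ _ → ⊥-elim (no-edge (≤-trans 2+i≤n short)))
  , (λ i 3+i≤n _ _ _ → ⊥-elim (no-edge (≤-trans (≤-trans (n≤1+n _) 3+i≤n) short)))
  where
  no-edge : ∀ {i} → ¬ (suc (suc i) ≤ 1)
  no-edge (s≤s ())

nonSimple-long : ∀ C → ¬ Simple C → 2 ≤ length C
nonSimple-long C nonSimple = ≰⇒> (λ short → nonSimple (short-simple C short))

nodes : Tree → ℕ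
nodes (leaf _)     = 1
nodes (node _ l r) = 1 + nodes l + nodes r

-- The recursion tree on a non-empty chain of n points has fewer than 2n
-- nodes: it is a binary tree whose leaves are disjoint non-empty subchains.
nodes-bound : ∀ {C t} → TAD C t → 1 ≤ length C → nodes t < 2 * length C
nodes-bound (tad-leaf _) nonempty = *-monoʳ-≤ 2 nonempty
nodes-bound {C} {node _ l r} (tad-node nonSimple tl tr) _ = begin
  suc (suc (nodes l + nodes r)) ≡⟨ cong suc (sym (+-suc (nodes l) (nodes r))) ⟩
  suc (nodes l) + suc (nodes r) ≤⟨ +-mono-≤ (nodes-bound tl firstNonempty) (nodes-bound tr secondNonempty) ⟩
  2 * length (firstHalf C) + 2 * length (secondHalf C) ≡⟨ sym (*-distribˡ-+ 2 (length (firstHalf C)) _) ⟩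
  2 * (length (firstHalf C) + length (secondHalf C)) ≡⟨ cong (2 *_) (halves-length C) ⟩
  2 * length C ∎
  where
  open ≤-Reasoning
  firstNonempty : 1 ≤ length (firstHalf C)
  firstNonempty  = proj₁ (halves-nonempty C (nonSimple-long C nonSimple))
  secondNonempty : 1 ≤ length (secondHalf C)
  secondNonempty = proj₂ (halves-nonempty C (nonSimple-long C nonSimple))

levelCount≤maxLevel : ∀ t {d m} → d ≤′ m → levelCount t d ≤ maxLevel t m
levelCount≤maxLevel t {m = zero}  ≤′-refl     = ≤-refl
levelCount≤maxLevel t {m = suc m} ≤′-refl     = m≤n⊔m (maxLevel t m) _
levelCount≤maxLevel t {m = suc m} (≤′-step p) = ≤-trans (levelCount≤maxLevel t p) (m≤m⊔n _ _)

levelCount≤width : ∀ t d → d ≤ depth t → levelCount t d ≤ width t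
levelCount≤width t d d≤D = levelCount≤maxLevel t (≤⇒≤′ d≤D)

width-positive : ∀ t → 1 ≤ width t
width-positive t@(leaf _)     = levelCount≤width t 0 z≤n
width-positive t@(node _ _ _) = levelCount≤width t 0 z≤n

-- The weighted level count Σ_{d ≤ D} 2^(D-d) · levelCount t d:
-- the number of nodes at depth d weighted by 2^D / 2^d.
weightedCount : ℕ → Tree → ℕ
weightedCount zero    t = levelCount t zero
weightedCount (suc D) t = 2 * weightedCount D t + levelCount t (suc D)

weightedCount-leaf : ∀ C D → weightedCount D (leaf C) ≡ 2 ^ D
weightedCount-leaf C zero    = refl
weightedCount-leaf C (suc D) rewrite weightedCount-leaf C D = +-identityʳ _

weightedCount-node : ∀ C l r D →
  weightedCount (suc D) (node C l r) ≡ 2 ^ suc D + weightedCount D l + weightedCount D r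
weightedCount-node C l r zero = regroup (levelCount l 0) (levelCount r 0)
  where
  regroup : ∀ x y → 2 * 1 + (x + y) ≡ 2 * 1 + x + y
  regroup = solve-∀
weightedCount-node C l r (suc D) rewrite weightedCount-node C l r D =
  regroup (2 ^ D) (weightedCount D l) (weightedCount D r) (levelCount l (suc D)) (levelCount r (suc D))
  where
  regroup : ∀ p x y u v → 2 * (2 * p + x + y) + (u + v) ≡ 2 * (2 * p) + (2 * x + u) + (2 * y + v)
  regroup = solve-∀

-- Geometric series: if levels 0..D have at most M nodes each, then
-- Σ_{d ≤ D} 2^(D-d) · M + M = 2^(D+1) · M bounds the weighted count plus M.
weightedCount-bound : ∀ t M D → (∀ d → d ≤ D → levelCount t d ≤ M) →
  weightedCount D t + M ≤ 2 ^ suc D * M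
weightedCount-bound t M zero levels≤M = ≤-trans (+-monoˡ-≤ M (levels≤M 0 z≤n)) (≤-reflexive (double M))
  where
  double : ∀ M → M + M ≡ 2 ^ 1 * M
  double = solve-∀
weightedCount-bound t M (suc D) levels≤M = begin
  2 * W + levelCount t (suc D) + M ≤⟨ +-monoˡ-≤ M (+-monoʳ-≤ (2 * W) (levels≤M (suc D) ≤-refl)) ⟩
  2 * W + M + M                    ≡⟨ regroup W M ⟩
  2 * (W + M)                      ≤⟨ *-monoʳ-≤ 2 (weightedCount-bound t M D (λ d d≤D → levels≤M d (m≤n⇒m≤1+n d≤D))) ⟩
  2 * (2 ^ suc D * M)              ≡⟨ sym (*-assoc 2 (2 ^ suc D) M) ⟩
  2 ^ suc (suc D) * M              ∎
  where
  open ≤-Reasoning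
  W = weightedCount D t
  regroup : ∀ w M → 2 * w + M + M ≡ 2 * (w + M)
  regroup = solve-∀

weightedCount≤width : ∀ t → weightedCount (depth t) t ≤ 2 ^ suc (depth t) * width t
weightedCount≤width t = m+n≤o⇒m≤o _ (weightedCount-bound t (width t) (depth t) (levelCount≤width t))

totalSize : Tree → ℕ
totalSize (leaf C)     = length C
totalSize (node C l r) = length C + totalSize l + totalSize r

time-split : ∀ a b t → time a b t ≡ a * totalSize t + b * nodes t
time-split a b (leaf C) = cong (a * length C +_) (sym (*-identityʳ b))
time-split a b (node C l r) rewrite time-split a b l | time-split a b r =
  regroup a b (length C) (totalSize l) (totalSize r) (nodes l) (nodes r)
  where
  regroup : ∀ a b m sl sr nl nr →
    a * m + b + (a * sl + b * nl) + (a * sr + b * nr) ≡ a * (m + sl + sr) + b * (1 + nl + nr)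
  regroup = solve-∀

-- If a chain of m points satisfies s·m ≤ N + s (that is, m ≤ N/s + 1) and a
-- piece of it holds at most half of m + 1 points, the piece satisfies the
-- same bound at scale 2s.
halved-scale : ∀ N s m {k} → s * m ≤ N + s → k + k ≤ suc m → 2 * s * k ≤ N + 2 * s
halved-scale N s m {k} sm≤N+s k≤half = begin
  2 * s * k   ≡⟨ double-left s k ⟩
  s * (k + k) ≤⟨ *-monoʳ-≤ s k≤half ⟩
  s * suc m   ≡⟨ *-suc s m ⟩
  s + s * m   ≤⟨ +-monoʳ-≤ s sm≤N+s ⟩
  s + (N + s) ≡⟨ double-right s N ⟩
  N + 2 * s   ∎
  where
  open ≤-Reasoning
  double-left : ∀ s k → 2 * s * k ≡ s * (k + k)
  double-left = solve-∀
  double-right : ∀ s N → s + (N + s) ≡ N + 2 * s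
  double-right = solve-∀

-- The core estimate, scaled by 2^D to stay in ℕ: if the chain at the root
-- of t has m ≤ N/s + 1 points, then every node at depth d below it has at
-- most N/(2^d s) + 1 points, and summing over the nodes gives
--   2^D · s · totalSize t ≤ N · weightedCount D t + 2^D · s · nodes t.
size-bound : ∀ {C t} → TAD C t → ∀ N s D → depth t ≤ D → s * length C ≤ N + s →
  2 ^ D * s * totalSize t ≤ N * weightedCount D t + 2 ^ D * s * nodes t
size-bound {C} (tad-leaf _) N s D _ sm≤N+s rewrite weightedCount-leaf C D = begin
  2 ^ D * s * length C     ≡⟨ *-assoc (2 ^ D) s (length C) ⟩
  2 ^ D * (s * length C)   ≤⟨ *-monoʳ-≤ (2 ^ D) sm≤N+s ⟩
  2 ^ D * (N + s)          ≡⟨ regroup (2 ^ D) N s ⟩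
  N * 2 ^ D + 2 ^ D * s * 1 ∎
  where
  open ≤-Reasoning
  regroup : ∀ B N s → B * (N + s) ≡ N * B + B * s * 1
  regroup = solve-∀
size-bound (tad-node _ _ _) N s zero () _
size-bound {C} {node _ l r} (tad-node _ tl tr) N s (suc D) depth≤ sm≤N+s
  rewrite weightedCount-node C l r D = begin
  2 * B * s * (m + totalSize l + totalSize r)
    ≡⟨ regroup-left B s m (totalSize l) (totalSize r) ⟩
  2 * B * (s * m) + B * (2 * s) * totalSize l + B * (2 * s) * totalSize r
    ≤⟨ +-mono-≤ (+-mono-≤ (*-monoʳ-≤ (2 * B) sm≤N+s) left) right ⟩
  2 * B * (N + s) + (N * Wl + B * (2 * s) * nodes l) + (N * Wr + B * (2 * s) * nodes r)
    ≡⟨ regroup-right B N s Wl Wr (nodes l) (nodes r) ⟩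
  N * (2 * B + Wl + Wr) + 2 * B * s * (1 + nodes l + nodes r) ∎
  where
  open ≤-Reasoning
  B = 2 ^ D
  m = length C
  Wl = weightedCount D l
  Wr = weightedCount D r
  depths≤D : depth l ⊔ depth r ≤ D
  depths≤D = s≤s⁻¹ depth≤
  left : B * (2 * s) * totalSize l ≤ N * Wl + B * (2 * s) * nodes l
  left = size-bound tl N (2 * s) D (m⊔n≤o⇒m≤o _ _ depths≤D) (halved-scale N s m sm≤N+s (firstHalf-short C))
  right : B * (2 * s) * totalSize r ≤ N * Wr + B * (2 * s) * nodes r
  right = size-bound tr N (2 * s) D (m⊔n≤o⇒n≤o _ _ depths≤D) (halved-scale N s m sm≤N+s (secondHalf-short C))
  regroup-left : ∀ B s m sl sr →
    2 * B * s * (m + sl + sr) ≡ 2 * B * (s * m) + B * (2 * s) * sl + B * (2 * s) * sr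
  regroup-left = solve-∀
  regroup-right : ∀ B N s wl wr nl nr →
    2 * B * (N + s) + (N * wl + B * (2 * s) * nl) + (N * wr + B * (2 * s) * nr)
      ≡ N * (2 * B + wl + wr) + 2 * B * s * (1 + nl + nr)
  regroup-right = solve-∀

-- Unscaled at the root (s = 1, N = n, D = depth t): the total size is at
-- most 2ωn plus the number of nodes.
totalSize-bound : ∀ {C t} → TAD C t → totalSize t ≤ 2 * width t * length C + nodes t
totalSize-bound {C} {t} tad = *-cancelˡ-≤ (2 ^ D) {{m^n≢0 2 D}} (begin
  2 ^ D * totalSize t                        ≡⟨ cong (_* totalSize t) (sym (*-identityʳ (2 ^ D))) ⟩
  2 ^ D * 1 * totalSize t                    ≤⟨ size-bound tad n 1 D ≤-refl n≤n+1 ⟩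
  n * weightedCount D t + 2 ^ D * 1 * nodes t ≤⟨ +-monoˡ-≤ _ (*-monoʳ-≤ n (weightedCount≤width t)) ⟩
  n * (2 ^ suc D * ω) + 2 ^ D * 1 * nodes t   ≡⟨ regroup (2 ^ D) n ω (nodes t) ⟩
  2 ^ D * (2 * ω * n + nodes t)               ∎)
  where
  open ≤-Reasoning
  D = depth t
  n = length C
  ω = width t
  n≤n+1 : 1 * n ≤ n + 1
  n≤n+1 = ≤-trans (≤-reflexive (*-identityˡ n)) (m≤m+n n 1)
  regroup : ∀ B n ω c → n * (2 * B * ω) + B * 1 * c ≡ B * (2 * ω * n + c)
  regroup = solve-∀

-- The theorem: time ≤ (4a + 2b) · ω · n.  Both the count part (fewer than
-- 2n nodes) and the extra nodes in the size part are absorbed using ω ≥ 1.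
lemma1 : (a b : ℕ) → ∃[ c ] (∀ (C : Chain) (t : Tree) → 1 ≤ length C → TAD C t →
           time a b t ≤ c * width t * length C)
lemma1 a b = 4 * a + 2 * b , bound
  where
  bound : ∀ C t → 1 ≤ length C → TAD C t → time a b t ≤ (4 * a + 2 * b) * width t * length C
  bound C t nonempty tad = begin
    time a b t                                         ≡⟨ time-split a b t ⟩
    a * totalSize t + b * nodes t                      ≤⟨ +-mono-≤ (*-monoʳ-≤ a sizeBound) (*-monoʳ-≤ b countBound) ⟩
    a * (2 * ω * n + ω * (2 * n)) + b * (ω * (2 * n)) ≡⟨ regroup a b ω n ⟩
    (4 * a + 2 * b) * ω * n                            ∎
    where
    open ≤-Reasoning
    n = length C
    ω = width t
    countBound : nodes t ≤ ω * (2 * n)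
    countBound = ≤-trans (<⇒≤ (nodes-bound tad nonempty)) (m≤n*m (2 * n) ω {{>-nonZero (width-positive t)}})
    sizeBound : totalSize t ≤ 2 * ω * n + ω * (2 * n)
    sizeBound = ≤-trans (totalSize-bound tad) (+-monoʳ-≤ (2 * ω * n) countBound)
    regroup : ∀ a b ω n → a * (2 * ω * n + ω * (2 * n)) + b * (ω * (2 * n)) ≡ (4 * a + 2 * b) * ω * n
    regroup = solve-∀
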